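{- Let $G$ be a graph, $\mathcal{F}$ a family of vertex subsets of $G$, $A,B\subseteq V(G)$, and let $\{x_F\}_{F\in\mathcal{F}}$ be an optimal solution to the linear program: minimize $\sum_{F\in\mathcal{F}}x_F$ subject to $x_F\ge 0$ and $\sum_{F\in\mathcal{F},\,F\cap P\ne\emptyset}x_F\ge1$ for every induced $A$--$B$ path $P$ in $G$. Then there exists another feasible solution $\{y_F\}_{F\in\mathcal{F}}$ of this linear program satisfying $1\ge y_F\ge\frac{1}{|\mathcal{F}|}$ for every $F\in\mathcal{F}$ with $y_F>0$, and $\sum_{F\in\mathcal{F}}y_F\le 2\sum_{F\in\mathcal{F}}x_F$.
   Context: An $A$--$B$ path is a path starting in $A$ and ending in $B$; it is induced if it is an induced subgraph of $G$. -}

module Defs where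

open import Data.Nat using (ℕ; zero; suc)
open import Data.Fin using (Fin; zero; suc; toℕ; fromℕ)
open import Data.Fin.Subset using (Subset; _∈_)
open import Data.Vec using (lookup)
open import Data.Bool using (Bool; if_then_else_)
open import Data.List using (allFin)
open import Data.Bool.ListAction using (any)
open import Data.Integer using (+_)
open import Data.Rational using (ℚ; 0ℚ; 1ℚ; _+_; _*_; _≤_; _<_; _/_)
open import Data.Product using (_×_; Σ; ∃)
open import Data.Sum using (_⊎_)
open import Relation.Binary.PropositionalEquality using (_≡_)
open import Relation.Nullary using (¬_)
open import Function.Definitions using (Injective)

record SimpleGraph (n : ℕ) : Set₁ where
  field
    Adj    : Fin n → Fin n → Set
    sym    : ∀ {u v} → Adj u v → Adj v u
    irrefl : ∀ {v} → ¬ Adj v v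
open SimpleGraph public

IsPath : ∀ {n} → SimpleGraph n → (k : ℕ) → (Fin (suc k) → Fin n) → Set
IsPath G k p =
  Injective _≡_ _≡_ p ×
  (∀ (i j : Fin (suc k)) → toℕ j ≡ suc (toℕ i) → Adj G (p i) (p j))

IsInducedPath : ∀ {n} → SimpleGraph n → (k : ℕ) → (Fin (suc k) → Fin n) → Set
IsInducedPath G k p =
  IsPath G k p ×
  (∀ (i j : Fin (suc k)) → Adj G (p i) (p j) →
      (toℕ j ≡ suc (toℕ i)) ⊎ (toℕ i ≡ suc (toℕ j)))

IsInducedABPath : ∀ {n} → SimpleGraph n → Subset n → Subset n →
                  (k : ℕ) → (Fin (suc k) → Fin n) → Set
IsInducedABPath G A B k p =
  IsInducedPath G k p × (p zero ∈ A) × (p (fromℕ k) ∈ B)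

meets : ∀ {n k} → Subset n → (Fin (suc k) → Fin n) → Bool
meets {k = k} F p = any (λ i → lookup F (p i)) (allFin (suc k))

∑ : (m : ℕ) → (Fin m → ℚ) → ℚ
∑ zero    f = 0ℚ
∑ (suc m) f = f zero + ∑ m (λ i → f (suc i))

-- The value 1/m (with the convention 1/0 := 0, irrelevant since then
-- there are no members of the family).
recip : ℕ → ℚ
recip zero    = 0ℚ
recip (suc m) = + 1 / suc m

Feasible : ∀ {n m} → SimpleGraph n → Subset n → Subset n →
           (Fin m → Subset n) → (Fin m → ℚ) → Set
Feasible {n} {m} G A B 𝓕 x =
  (∀ F → 0ℚ ≤ x F) ×
  (∀ (k : ℕ) (p : Fin (suc k) → Fin n) → IsInducedABPath G A B k p →
     1ℚ ≤ ∑ m (λ F → if meets (𝓕 F) p then x F else 0ℚ))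

Optimal : ∀ {n m} → SimpleGraph n → Subset n → Subset n →
          (Fin m → Subset n) → (Fin m → ℚ) → Set
Optimal {n} {m} G A B 𝓕 x =
  Feasible G A B 𝓕 x × (∀ z → Feasible G A B 𝓕 z → ∑ m x ≤ ∑ m z)

-- Round each doubled weight 2 x_F: up to 1 once it reaches 1, down to 0 below the
-- threshold 1/|𝓕|, unchanged in between. Rounding never increases 2 x_F, so the total
-- at most doubles. On an induced A–B path either some set meeting it has 2 x_F ≥ 1 and
-- is rounded up to 1, or every set meeting it loses less than 1/|𝓕| of its doubled
-- weight, so the rounded weights on the path sum to at least 2 - |𝓕| · 1/|𝓕| = 1.
module Submission where

open import Defs using (SimpleGraph; Optimal; Feasible; IsInducedABPath; meets; ∑; recip)
open import Data.Nat using (ℕ; zero; suc)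
import Data.Nat as ℕ
import Data.Nat.Coprimality as Coprime
open import Data.Fin using (Fin; zero; suc)
open import Data.Fin.Properties using (any?)
open import Data.Fin.Subset using (Subset)
open import Data.Bool using (Bool; true; false; if_then_else_) renaming (_≟_ to _≟ᵇ_)
open import Data.Integer as ℤ using (+_; +≤+)
import Data.Integer.Properties as ℤₚ
open import Data.Rational
  using (ℚ; mkℚ; 0ℚ; 1ℚ; _+_; _*_; _≤_; _<_; _≰_; _/_; -_; _≤?_; toℚᵘ; *≤*)
open import Data.Rational.Properties
import Data.Rational.Unnormalised as ℚᵘ
import Data.Rational.Unnormalised.Properties as ℚᵘ
import Data.Rational.Solver
open import Data.Product using (_×_; Σ; _,_)
open import Relation.Binary.PropositionalEquality
  using (_≡_; refl; sym; trans; cong; subst; subst₂; module ≡-Reasoning)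
open import Relation.Nullary using (yes; no; contradiction)
open import Relation.Nullary.Decidable using (_×-dec_)
open import Function.Base using (_∘_)
open import Function.Definitions using (Injective)

2ℚ : ℚ
2ℚ = + 2 / 1

+-cancelʳ-≤ : ∀ r {p q} → p + r ≤ q + r → p ≤ q
+-cancelʳ-≤ r {p} {q} p+r≤q+r = subst₂ _≤_ (cancel p) (cancel q) (+-monoˡ-≤ (- r) p+r≤q+r)
  where
  cancel : ∀ s → s + r + - r ≡ s
  cancel s = trans (+-assoc s r (- r)) (trans (cong (λ t → s + t) (+-inverseʳ r)) (+-identityʳ s))

suc/1≡1+/1 : ∀ n → + suc n / 1 ≡ 1ℚ + + n / 1
suc/1≡1+/1 n = toℚᵘ-injective (begin-equality
  toℚᵘ (+ suc n / 1)                ≃⟨ toℚᵘ-fromℚᵘ (ℚᵘ.mkℚᵘ (+ suc n) 0) ⟩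
  ℚᵘ.mkℚᵘ (+ suc n) 0               ≃⟨ ℚᵘ.*≡* numerators ⟩
  toℚᵘ 1ℚ ℚᵘ.+ ℚᵘ.mkℚᵘ (+ n) 0     ≃⟨ ℚᵘ.+-congʳ (toℚᵘ 1ℚ) (toℚᵘ-fromℚᵘ (ℚᵘ.mkℚᵘ (+ n) 0)) ⟨
  toℚᵘ 1ℚ ℚᵘ.+ toℚᵘ (+ n / 1)      ≃⟨ toℚᵘ-homo-+ 1ℚ (+ n / 1) ⟨
  toℚᵘ (1ℚ + + n / 1)               ∎)
  where
  open ℚᵘ.≤-Reasoning
  numerators : + suc n ℤ.* + 1 ≡ (+ 1 ℤ.+ + n ℤ.* + 1) ℤ.* + 1
  numerators = trans (ℤₚ.*-identityʳ _)
    (sym (trans (ℤₚ.*-identityʳ _) (cong (λ k → + 1 ℤ.+ k) (ℤₚ.*-identityʳ (+ n)))))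

recip-suc≡mkℚ : ∀ n → recip (suc n) ≡ mkℚ (+ 1) n (Coprime.1-coprimeTo (suc n))
recip-suc≡mkℚ n = normalize-coprime _

/1≡mkℚ : ∀ n → + n / 1 ≡ mkℚ (+ n) 0 (Coprime.sym (Coprime.1-coprimeTo n))
/1≡mkℚ n = normalize-coprime _

/1*recip≡1 : ∀ n → (+ suc n / 1) * recip (suc n) ≡ 1ℚ
/1*recip≡1 n rewrite /1≡mkℚ (suc n) | recip-suc≡mkℚ n =
  *-inverseʳ (mkℚ (+ suc n) 0 (Coprime.sym (Coprime.1-coprimeTo (suc n))))

recip-nonNeg : ∀ m → 0ℚ ≤ recip m
recip-nonNeg zero    = ≤-refl
recip-nonNeg (suc n) rewrite recip-suc≡mkℚ n = *≤* (+≤+ ℕ.z≤n)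

recip≤1 : ∀ m → recip m ≤ 1ℚ
recip≤1 zero    = *≤* (+≤+ ℕ.z≤n)
recip≤1 (suc n) rewrite recip-suc≡mkℚ n = *≤* (+≤+ (ℕ.s≤s ℕ.z≤n))

∑-nonNeg : ∀ m {f : Fin m → ℚ} → (∀ i → 0ℚ ≤ f i) → 0ℚ ≤ ∑ m f
∑-nonNeg zero    f≥0 = ≤-refl
∑-nonNeg (suc m) f≥0 = +-mono-≤ (f≥0 zero) (∑-nonNeg m (f≥0 ∘ suc))

term≤∑ : ∀ m {f : Fin m → ℚ} → (∀ i → 0ℚ ≤ f i) → ∀ i → f i ≤ ∑ m f
term≤∑ (suc m) {f} f≥0 zero = subst (_≤ ∑ (suc m) f) (+-identityʳ (f zero))
  (+-monoʳ-≤ (f zero) (∑-nonNeg m (f≥0 ∘ suc)))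
term≤∑ (suc m) {f} f≥0 (suc i) = subst (_≤ ∑ (suc m) f) (+-identityˡ (f (suc i)))
  (+-mono-≤ (f≥0 zero) (term≤∑ m (f≥0 ∘ suc) i))

∑-mono-≤ : ∀ m {f g : Fin m → ℚ} → (∀ i → f i ≤ g i) → ∑ m f ≤ ∑ m g
∑-mono-≤ zero    f≤g = ≤-refl
∑-mono-≤ (suc m) f≤g = +-mono-≤ (f≤g zero) (∑-mono-≤ m (f≤g ∘ suc))

∑-distrib-+ : ∀ m (f g : Fin m → ℚ) → ∑ m (λ i → f i + g i) ≡ ∑ m f + ∑ m g
∑-distrib-+ zero    f g = refl
∑-distrib-+ (suc m) f g = begin
  (f zero + g zero) + ∑ m (λ i → f (suc i) + g (suc i))
    ≡⟨ cong (λ s → (f zero + g zero) + s) (∑-distrib-+ m _ _) ⟩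
  (f zero + g zero) + (∑ m (f ∘ suc) + ∑ m (g ∘ suc))
    ≡⟨ solve 4 (λ a b c d → (a :+ b) :+ (c :+ d) := (a :+ c) :+ (b :+ d)) refl
         (f zero) (g zero) (∑ m (f ∘ suc)) (∑ m (g ∘ suc)) ⟩
  (f zero + ∑ m (f ∘ suc)) + (g zero + ∑ m (g ∘ suc))
    ∎
  where
  open ≡-Reasoning
  open Data.Rational.Solver.+-*-Solver

*-distribˡ-∑ : ∀ c m (f : Fin m → ℚ) → ∑ m (λ i → c * f i) ≡ c * ∑ m f
*-distribˡ-∑ c zero    f = sym (*-zeroʳ c)
*-distribˡ-∑ c (suc m) f =
  trans (cong (λ s → c * f zero + s) (*-distribˡ-∑ c m (f ∘ suc))) (sym (*-distribˡ-+ c _ _))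

∑-const : ∀ m c → ∑ m (λ _ → c) ≡ (+ m / 1) * c
∑-const zero    c = sym (*-zeroˡ c)
∑-const (suc m) c = begin
  c + ∑ m (λ _ → c)         ≡⟨ cong (λ s → c + s) (∑-const m c) ⟩
  c + (+ m / 1) * c         ≡⟨ cong (λ s → s + (+ m / 1) * c) (*-identityˡ c) ⟨
  1ℚ * c + (+ m / 1) * c    ≡⟨ *-distribʳ-+ c 1ℚ (+ m / 1) ⟨
  (1ℚ + + m / 1) * c        ≡⟨ cong (_* c) (suc/1≡1+/1 m) ⟨
  (+ suc m / 1) * c         ∎
  where open ≡-Reasoning

∑-recip≤1 : ∀ m → ∑ m (λ _ → recip m) ≤ 1ℚ
∑-recip≤1 zero    = *≤* (+≤+ ℕ.z≤n)
∑-recip≤1 (suc n) = ≤-reflexive (trans (∑-const (suc n) (recip (suc n))) (/1*recip≡1 n))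

snap : ℚ → ℚ → ℚ
snap r a with 1ℚ ≤? a | r ≤? a
... | yes _ | _     = 1ℚ
... | no _  | yes _ = a
... | no _  | no _  = 0ℚ

module _ {r : ℚ} (a : ℚ) where

  snap-nonNeg : 0ℚ ≤ r → 0ℚ ≤ snap r a
  snap-nonNeg 0≤r with 1ℚ ≤? a | r ≤? a
  ... | yes _ | _       = *≤* (+≤+ ℕ.z≤n)
  ... | no _  | yes r≤a = ≤-trans 0≤r r≤a
  ... | no _  | no _    = ≤-refl

  snap≤ : 0ℚ ≤ a → snap r a ≤ a
  snap≤ 0≤a with 1ℚ ≤? a | r ≤? a
  ... | yes 1≤a | _     = 1≤a
  ... | no _    | yes _ = ≤-refl
  ... | no _    | no _  = 0≤a

  snap-bounds : r ≤ 1ℚ → 0ℚ < snap r a → r ≤ snap r a × snap r a ≤ 1ℚ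
  snap-bounds r≤1 _ with 1ℚ ≤? a | r ≤? a
  ... | yes _  | _       = r≤1 , ≤-refl
  ... | no 1≰a | yes r≤a = r≤a , <⇒≤ (≰⇒> 1≰a)
  snap-bounds r≤1 0<0 | no _ | no _ = contradiction 0<0 (<-irrefl refl)

  snap-≥1 : 1ℚ ≤ a → snap r a ≡ 1ℚ
  snap-≥1 1≤a with 1ℚ ≤? a
  ... | yes _   = refl
  ... | no 1≰a = contradiction 1≤a 1≰a

  ≤snap+ : 0ℚ ≤ r → 1ℚ ≰ a → a ≤ snap r a + r
  ≤snap+ 0≤r 1≰a with 1ℚ ≤? a | r ≤? a
  ... | yes 1≤a | _      = contradiction 1≤a 1≰a
  ... | no _    | yes _  = subst (_≤ a + r) (+-identityʳ a) (+-monoʳ-≤ a 0≤r)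
  ... | no _    | no r≰a = subst (a ≤_) (sym (+-identityˡ r)) (<⇒≤ (≰⇒> r≰a))

mask : Bool → ℚ → ℚ
mask b a = if b then a else 0ℚ

mask-nonNeg : ∀ b {a} → 0ℚ ≤ a → 0ℚ ≤ mask b a
mask-nonNeg true  0≤a = 0≤a
mask-nonNeg false _   = ≤-refl

*-mask : ∀ c b a → c * mask b a ≡ mask b (c * a)
*-mask c true  a = refl
*-mask c false a = *-zeroʳ c

≤mask-snap+ : ∀ {r} b a → 0ℚ ≤ r → (b ≡ true → 1ℚ ≰ a) → mask b a ≤ mask b (snap r a) + r
≤mask-snap+ true  a 0≤r small = ≤snap+ a 0≤r (small refl)
≤mask-snap+ false a 0≤r _     = subst (0ℚ ≤_) (sym (+-identityˡ _)) 0≤r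

snap-preserves-cover : ∀ m (r : ℚ) → 0ℚ ≤ r → ∑ m (λ _ → r) ≤ 1ℚ →
  (w : Fin m → Bool) (x : Fin m → ℚ) →
  1ℚ ≤ ∑ m (λ i → mask (w i) (x i)) →
  1ℚ ≤ ∑ m (λ i → mask (w i) (snap r (2ℚ * x i)))
snap-preserves-cover m r 0≤r ∑r≤1 w x cover
  with any? (λ i → (w i ≟ᵇ true) ×-dec (1ℚ ≤? 2ℚ * x i))
... | yes (i , wi≡true , 1≤2xi) = begin
  1ℚ                                ≡⟨ snap-≥1 (2ℚ * x i) 1≤2xi ⟨
  snap r (2ℚ * x i)                 ≡⟨ cong (λ b → mask b (snap r (2ℚ * x i))) wi≡true ⟨
  mask (w i) (snap r (2ℚ * x i))    ≤⟨ term≤∑ m (λ j → mask-nonNeg (w j) (snap-nonNeg (2ℚ * x j) 0≤r)) i ⟩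
  ∑ m (λ j → mask (w j) (snap r (2ℚ * x j))) ∎
  where open ≤-Reasoning
... | no noneLarge = +-cancelʳ-≤ 1ℚ (begin
  1ℚ + 1ℚ                            ≡⟨⟩
  2ℚ * 1ℚ                            ≤⟨ *-monoˡ-≤-nonNeg 2ℚ cover ⟩
  2ℚ * ∑ m (λ i → mask (w i) (x i))  ≡⟨ *-distribˡ-∑ 2ℚ m _ ⟨
  ∑ m (λ i → 2ℚ * mask (w i) (x i))  ≤⟨ ∑-mono-≤ m loss ⟩
  ∑ m (λ i → ŷ i + r)                ≡⟨ ∑-distrib-+ m ŷ (λ _ → r) ⟩
  ∑ m ŷ + ∑ m (λ _ → r)              ≤⟨ +-monoʳ-≤ (∑ m ŷ) ∑r≤1 ⟩
  ∑ m ŷ + 1ℚ                         ∎)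
  where
  open ≤-Reasoning
  ŷ : Fin m → ℚ
  ŷ i = mask (w i) (snap r (2ℚ * x i))
  loss : ∀ i → 2ℚ * mask (w i) (x i) ≤ ŷ i + r
  loss i = subst (_≤ ŷ i + r) (sym (*-mask 2ℚ (w i) (x i)))
    (≤mask-snap+ (w i) (2ℚ * x i) 0≤r (λ wi≡true 1≤2xi → noneLarge (i , wi≡true , 1≤2xi)))

lemma4p2 : ∀ {n m : ℕ} (G : SimpleGraph n) (𝓕 : Fin m → Subset n)
    → Injective _≡_ _≡_ 𝓕
    → (A B : Subset n) (x : Fin m → ℚ)
    → Optimal G A B 𝓕 x
    → Σ (Fin m → ℚ) (λ y →
        Feasible G A B 𝓕 y
        × (∀ F → 0ℚ < y F → (recip m ≤ y F) × (y F ≤ 1ℚ))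
        × (∑ m y ≤ (+ 2 / 1) * ∑ m x))
lemma4p2 {m = m} G 𝓕 _ A B x ((x≥0 , x-covers) , _) =
  y , (y≥0 , y-covers) , (λ F → snap-bounds (2ℚ * x F) (recip≤1 m)) , ∑y≤2∑x
  where
  y : Fin m → ℚ
  y F = snap (recip m) (2ℚ * x F)

  y≥0 : ∀ F → 0ℚ ≤ y F
  y≥0 F = snap-nonNeg (2ℚ * x F) (recip-nonNeg m)

  y-covers : ∀ k p → IsInducedABPath G A B k p →
             1ℚ ≤ ∑ m (λ F → mask (meets (𝓕 F) p) (y F))
  y-covers k p path = snap-preserves-cover m (recip m) (recip-nonNeg m) (∑-recip≤1 m)
    (λ F → meets (𝓕 F) p) x (x-covers k p path)

  ∑y≤2∑x : ∑ m y ≤ 2ℚ * ∑ m x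
  ∑y≤2∑x = ≤-trans (∑-mono-≤ m (λ F → snap≤ (2ℚ * x F) (2x≥0 F)))
                   (≤-reflexive (*-distribˡ-∑ 2ℚ m x))
    where
    2x≥0 : ∀ F → 0ℚ ≤ 2ℚ * x F
    2x≥0 F = subst (_≤ 2ℚ * x F) (*-zeroʳ 2ℚ) (*-monoˡ-≤-nonNeg 2ℚ (x≥0 F))
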